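{- Let $X$ and $Y$ be graphs on $n$ vertices. If $u, v \in V(Y)$ have the same set of neighbors in $Y$, then for any bijections $\sigma, \sigma'$ lying in the same connected component of $\mathsf{FS}(X,Y)$, $u$ and $v$ are $(X,Y)$-exchangeable from $\sigma$ if and only if they are $(X,Y)$-exchangeable from $\sigma'$.
   Context: All graphs are simple. For graphs $X, Y$ on $n$ vertices, the friends-and-strangers graph $\mathsf{FS}(X,Y)$ has as vertices all bijections $\sigma: V(X) \to V(Y)$; two bijections $\sigma, \sigma'$ are adjacent iff there is an edge $\{a,b\} \in E(X)$ with $\{\sigma(a),\sigma(b)\} \in E(Y)$, $\sigma'(a) = \sigma(b)$, $\sigma'(b) = \sigma(a)$, and $\sigma'(c) = \sigma(c)$ for all other $c$ (an $(X,Y)$-friendly swap). For a bijection $\sigma$ and $u, v \in V(Y)$, $u$ and $v$ are $(X,Y)$-exchangeable from $\sigma$ if some sequence of $(X,Y)$-friendly swaps takes $\sigma$ to $(u\; v)\circ\sigma$. -}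

module Defs where

open import Level using (0ℓ)
open import Data.Nat using (ℕ)
open import Data.Fin using (Fin)
open import Data.Fin.Permutation using (Permutation′; _⟨$⟩ʳ_; _≈_; transpose; _∘ₚ_)
open import Data.Product using (Σ; ∃; _×_; _,_)
open import Relation.Nullary using (¬_)
open import Relation.Binary.PropositionalEquality using (_≡_; _≢_)
open import Relation.Binary.Construct.Closure.ReflexiveTransitive using (Star)

record Graph (n : ℕ) : Set₁ where
  field
    Adj   : Fin n → Fin n → Set
    sym   : ∀ {a b} → Adj a b → Adj b a
    irrefl : ∀ {a} → ¬ Adj a a
open Graph public

-- Bijections V(X) → V(Y); both vertex sets are Fin n.
Bij : ℕ → Set
Bij n = Permutation′ n

FriendlySwap : ∀ {n} → Graph n → Graph n → Bij n → Bij n → Set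
FriendlySwap {n} X Y σ σ' =
  Σ (Fin n) λ a → Σ (Fin n) λ b →
    Adj X a b × Adj Y (σ ⟨$⟩ʳ a) (σ ⟨$⟩ʳ b)
    × σ' ⟨$⟩ʳ a ≡ σ ⟨$⟩ʳ b × σ' ⟨$⟩ʳ b ≡ σ ⟨$⟩ʳ a
    × (∀ c → c ≢ a → c ≢ b → σ' ⟨$⟩ʳ c ≡ σ ⟨$⟩ʳ c)

Connected : ∀ {n} → Graph n → Graph n → Bij n → Bij n → Set
Connected X Y σ τ = ∃ λ ρ → Star (FriendlySwap X Y) σ ρ × ρ ≈ τ

Exchangeable : ∀ {n} → Graph n → Graph n → Fin n → Fin n → Bij n → Set
Exchangeable X Y u v σ = Connected X Y σ (σ ∘ₚ transpose u v)

-- Post-composing every bijection with a fixed automorphism π of Y maps friendly swaps to friendly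
-- swaps, so σ ↦ π ∘ σ preserves the components of FS(X,Y). When u and v have the same neighbours
-- in Y, the transposition (u v) is such an automorphism. Hence if σ ~ σ' and σ ~ (u v) ∘ σ, then
-- σ' ~ σ ~ (u v) ∘ σ ~ (u v) ∘ σ'. (Note that σ ∘ₚ π is π ∘ σ: composition is diagrammatic.)
module Submission where

open import Defs
open import Data.Nat using (ℕ)
open import Data.Fin using (Fin; _≟_)
open import Data.Fin.Permutation using (Permutation′; _⟨$⟩ʳ_; _≈_; transpose; _∘ₚ_)
import Data.Fin.Permutation.Components as PC
open import Data.Product using (_×_; _,_; proj₁; proj₂)
open import Relation.Nullary using (yes; no)
open import Relation.Binary.PropositionalEquality using (_≡_; refl; trans; cong; subst₂) renaming (sym to ≡-sym)
open import Relation.Binary.Construct.Closure.ReflexiveTransitive using (Star; ε; _◅_; _◅◅_; gmap; reverse)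

Twins : ∀ {n} → Graph n → Fin n → Fin n → Set
Twins Y u v = ∀ w → (Adj Y u w → Adj Y v w) × (Adj Y v w → Adj Y u w)

PreservesAdj : ∀ {n} → Graph n → Permutation′ n → Set
PreservesAdj Y π = ∀ {x y} → Adj Y x y → Adj Y (π ⟨$⟩ʳ x) (π ⟨$⟩ʳ y)

module _ {n : ℕ} (Y : Graph n) {u v : Fin n} (twins : Twins Y u v) where

  transpose-preservesAdjˡ : ∀ {x y} → Adj Y x y → Adj Y (PC.transpose u v x) y
  transpose-preservesAdjˡ {x} {y} xy with x ≟ u
  ... | yes refl = proj₁ (twins y) xy
  ... | no _ with x ≟ v
  ...   | yes refl = proj₂ (twins y) xy
  ...   | no _ = xy

  twins⇒transpose-preservesAdj : PreservesAdj Y (transpose u v)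
  twins⇒transpose-preservesAdj xy =
    Graph.sym Y (transpose-preservesAdjˡ (Graph.sym Y (transpose-preservesAdjˡ xy)))

module _ {n : ℕ} (X Y : Graph n) where

  FriendlySwap-sym : ∀ {σ σ'} → FriendlySwap X Y σ σ' → FriendlySwap X Y σ' σ
  FriendlySwap-sym (a , b , ab , σaσb , σ'a , σ'b , σ'c) =
    a , b , ab , subst₂ (Adj Y) (≡-sym σ'a) (≡-sym σ'b) (Graph.sym Y σaσb) ,
    ≡-sym σ'b , ≡-sym σ'a ,
    λ c c≢a c≢b → ≡-sym (σ'c c c≢a c≢b)

  FriendlySwap-respˡ-≈ : ∀ {τ ρ ρ'} → τ ≈ ρ → FriendlySwap X Y ρ ρ' → FriendlySwap X Y τ ρ'
  FriendlySwap-respˡ-≈ τ≈ρ (a , b , ab , ρaρb , ρ'a , ρ'b , ρ'c) =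
    a , b , ab , subst₂ (Adj Y) (≡-sym (τ≈ρ a)) (≡-sym (τ≈ρ b)) ρaρb ,
    trans ρ'a (≡-sym (τ≈ρ b)) , trans ρ'b (≡-sym (τ≈ρ a)) ,
    λ c c≢a c≢b → trans (ρ'c c c≢a c≢b) (≡-sym (τ≈ρ c))

  Star-respˡ-≈ : ∀ {τ ρ σ} → τ ≈ ρ → Star (FriendlySwap X Y) ρ σ → Connected X Y τ σ
  Star-respˡ-≈ {τ} τ≈ρ ε        = τ , ε , τ≈ρ
  Star-respˡ-≈ {τ} {ρ} {σ} τ≈ρ (_◅_ {j = ρ'} s ss) =
    σ , FriendlySwap-respˡ-≈ {τ} {ρ} {ρ'} τ≈ρ s ◅ ss , λ _ → refl

  Connected-sym : ∀ {σ τ} → Connected X Y σ τ → Connected X Y τ σ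
  Connected-sym (ρ , ss , ρ≈τ) =
    Star-respˡ-≈ (λ i → ≡-sym (ρ≈τ i)) (reverse (λ {σ} {σ'} → FriendlySwap-sym {σ} {σ'}) ss)

  Connected-trans : ∀ {σ τ κ} → Connected X Y σ τ → Connected X Y τ κ → Connected X Y σ κ
  Connected-trans (ρ , ss , ρ≈τ) (_ , ss' , ρ'≈κ) with Star-respˡ-≈ ρ≈τ ss'
  ... | ρ'' , ss'' , ρ''≈ρ' = ρ'' , ss ◅◅ ss'' , λ i → trans (ρ''≈ρ' i) (ρ'≈κ i)

  module _ (π : Permutation′ n) (π-preservesAdj : PreservesAdj Y π) where

    FriendlySwap-∘ₚ : ∀ {σ σ'} → FriendlySwap X Y σ σ' → FriendlySwap X Y (σ ∘ₚ π) (σ' ∘ₚ π)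
    FriendlySwap-∘ₚ (a , b , ab , σaσb , σ'a , σ'b , σ'c) =
      a , b , ab , π-preservesAdj σaσb , cong (π ⟨$⟩ʳ_) σ'a , cong (π ⟨$⟩ʳ_) σ'b ,
      λ c c≢a c≢b → cong (π ⟨$⟩ʳ_) (σ'c c c≢a c≢b)

    Connected-∘ₚ : ∀ {σ τ} → Connected X Y σ τ → Connected X Y (σ ∘ₚ π) (τ ∘ₚ π)
    Connected-∘ₚ (ρ , ss , ρ≈τ) =
      ρ ∘ₚ π , gmap (_∘ₚ π) (λ {σ} {σ'} → FriendlySwap-∘ₚ {σ} {σ'}) ss ,
      λ i → cong (π ⟨$⟩ʳ_) (ρ≈τ i)

    Connected-self-∘ₚ-transport : ∀ σ σ' → Connected X Y σ σ'
                                 → Connected X Y σ (σ ∘ₚ π) → Connected X Y σ' (σ' ∘ₚ π)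
    Connected-self-∘ₚ-transport σ σ' σ~σ' σ~σπ =
      Connected-trans {σ'} {σ} {σ' ∘ₚ π} (Connected-sym {σ} {σ'} σ~σ')
        (Connected-trans {σ} {σ ∘ₚ π} {σ' ∘ₚ π} σ~σπ (Connected-∘ₚ {σ} {σ'} σ~σ'))

lemma3p2 : ∀ {n} (X Y : Graph n) (u v : Fin n)
           → (∀ w → (Adj Y u w → Adj Y v w) × (Adj Y v w → Adj Y u w))
           → (σ σ' : Bij n) → Connected X Y σ σ'
           → (Exchangeable X Y u v σ → Exchangeable X Y u v σ')
             × (Exchangeable X Y u v σ' → Exchangeable X Y u v σ)
lemma3p2 X Y u v twins σ σ' σ~σ' =
  Connected-self-∘ₚ-transport X Y (transpose u v) transpose-preservesAdj σ σ' σ~σ' ,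
  Connected-self-∘ₚ-transport X Y (transpose u v) transpose-preservesAdj σ' σ
    (Connected-sym X Y {σ} {σ'} σ~σ')
  where
  transpose-preservesAdj : PreservesAdj Y (transpose u v)
  transpose-preservesAdj = twins⇒transpose-preservesAdj Y twins
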